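{- Let $n$ be a positive integer and $f:\{1,\ldots,n\}\to\{1,\ldots,n\}$ a map with $f(n)=n$ that is $n$-potent. Let $\sigma$ be a permutation of $\{1,\ldots,n\}$ with $\sigma\neq\mathrm{id}$. Then there exists some $i\in\{1,\ldots,n\}$ such that $\sigma(i)\notin\{i,f(i)\}$.
   Context: A map $f:\{1,\ldots,n\}\to\{1,\ldots,n\}$ is called $n$-potent if for every $i\in\{1,\ldots,n\}$ there exists $k\in\mathbb{N}=\{0,1,2,\ldots\}$ with $f^k(i)=n$ ($f^k$ the $k$-fold composite, $f^0=\mathrm{id}$). -}

module Defs where

open import Data.Nat using (ℕ; zero; suc)
open import Data.Fin using (Fin; fromℕ)
open import Data.Product using (∃)
open import Relation.Binary.PropositionalEquality using (_≡_)

iter : {A : Set} → (A → A) → ℕ → A → A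
iter f zero    x = x
iter f (suc k) x = f (iter f k x)

-- The set {1,…,n} with n = suc m is modelled as Fin (suc m);
-- the element n corresponds to fromℕ m (the largest element).
-- f is n-potent: every i reaches n under some iterate of f.
Potent : (m : ℕ) → (Fin (suc m) → Fin (suc m)) → Set
Potent m f = ∀ i → ∃ λ k → iter f k i ≡ fromℕ m

-- If every point is either fixed by σ or sent to its f-image, the points moved by σ are closed
-- under f: from σ (f i) = f i = σ i injectivity gives f i = i, so i was not moved after all.
-- Following f from a moved point therefore never meets a fixed point, yet it reaches n, which
-- σ fixes because f fixes it. Hence σ would be the identity.
module Submission where

open import Defs
open import Data.Nat using (ℕ; suc; zero)
open import Data.Fin using (Fin; fromℕ; _≟_)
open import Data.Fin.Permutation using (Permutation′; _⟨$⟩ʳ_)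
open import Data.Fin.Properties using (¬∀⟶∃¬)
open import Data.Product using (∃; _×_; _,_)
open import Data.Sum using (_⊎_; inj₁; inj₂)
open import Function using (_∘_; Injection)
open import Function.Definitions using (Injective)
open import Function.Properties.Inverse using (↔⇒↣)
open import Relation.Binary.PropositionalEquality using (_≡_; _≢_; sym; trans; subst)
open import Relation.Nullary using (¬_; contradiction)
open import Relation.Nullary.Decidable using (_⊎-dec_; decidable-stable)
open import Relation.Unary using (Decidable)

module _ {A : Set} {g f : A → A} (g-injective : Injective _≡_ _≡_ g)
         (fixes-or-follows : ∀ x → g x ≡ x ⊎ g x ≡ f x) where

  moved⇒f-moved : ∀ {x} → g x ≢ x → g (f x) ≢ f x
  moved⇒f-moved {x} gx≢x with fixes-or-follows x
  ... | inj₁ gx≡x  = contradiction gx≡x gx≢x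
  ... | inj₂ gx≡fx = λ gfx≡fx → gx≢x (trans gx≡fx (g-injective (trans gfx≡fx (sym gx≡fx))))

  moved⇒iter-moved : ∀ {x} → g x ≢ x → ∀ k → g (iter f k x) ≢ iter f k x
  moved⇒iter-moved gx≢x zero    = gx≢x
  moved⇒iter-moved gx≢x (suc k) = moved⇒f-moved (moved⇒iter-moved gx≢x k)

  f-fixed⇒fixed : ∀ {y} → f y ≡ y → g y ≡ y
  f-fixed⇒fixed {y} fy≡y with fixes-or-follows y
  ... | inj₁ gy≡y  = gy≡y
  ... | inj₂ gy≡fy = trans gy≡fy fy≡y

  reaches-f-fixed⇒¬moved : ∀ {x y} → f y ≡ y → ∃ (λ k → iter f k x ≡ y) → ¬ (g x ≢ x)
  reaches-f-fixed⇒¬moved fy≡y (k , fᵏx≡y) gx≢x =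
    moved⇒iter-moved gx≢x k (subst (λ z → g z ≡ z) (sym fᵏx≡y) (f-fixed⇒fixed fy≡y))

lemma3p7 : (m : ℕ) (f : Fin (suc m) → Fin (suc m)) →
    f (fromℕ m) ≡ fromℕ m → Potent m f →
    (σ : Permutation′ (suc m)) → ¬ (∀ i → σ ⟨$⟩ʳ i ≡ i) →
    ∃ λ i → (σ ⟨$⟩ʳ i ≢ i) × (σ ⟨$⟩ʳ i ≢ f i)
lemma3p7 m f fn≡n potent σ σ≢id with ¬∀⟶∃¬ (suc m) FixesOrFollows fixesOrFollows? ¬fixesOrFollows
  where
  FixesOrFollows : Fin (suc m) → Set
  FixesOrFollows i = σ ⟨$⟩ʳ i ≡ i ⊎ σ ⟨$⟩ʳ i ≡ f i

  fixesOrFollows? : Decidable FixesOrFollows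
  fixesOrFollows? i = (σ ⟨$⟩ʳ i ≟ i) ⊎-dec (σ ⟨$⟩ʳ i ≟ f i)

  ¬fixesOrFollows : ¬ (∀ i → FixesOrFollows i)
  ¬fixesOrFollows everywhere = σ≢id λ i →
    decidable-stable (σ ⟨$⟩ʳ i ≟ i)
      (reaches-f-fixed⇒¬moved (Injection.injective (↔⇒↣ σ)) everywhere fn≡n (potent i))
... | i , ¬fixesOrFollows-i = i , ¬fixesOrFollows-i ∘ inj₁ , ¬fixesOrFollows-i ∘ inj₂
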